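{- Let $h=\prod_{i=1}^{t}p_i^{s_i}$ with $p_1,\dots,p_t$ distinct primes and $s_i\geq 1$, and let $m\leq n$. Let $A=SDT\in\mathbb{Z}_h^{m\times n}$, where $S\in GL_m(\mathbb{Z}_h)$, $T\in GL_n(\mathbb{Z}_h)$ and $D=\mathrm{diag}(\prod_{i=1}^t p_i^{\alpha_{i1}},\ldots,\prod_{i=1}^t p_i^{\alpha_{im}})$ is an $m\times n$ diagonal matrix with $0\leq\alpha_{i1}\leq\cdots\leq\alpha_{im}\leq s_i$ for $i=1,\ldots,t$. Then the inner rank of $A$ is $\max\{c:(\alpha_{1c},\alpha_{2c},\ldots,\alpha_{tc})\neq(s_1,s_2,\ldots,s_t)\}$.
   Context: $\mathbb{Z}_h$ is the residue class ring modulo $h$. The inner rank $\rho(A)$ of a nonzero $A\in\mathbb{Z}_h^{m\times n}$ is the least integer $k$ such that $A=BC$ with $B\in\mathbb{Z}_h^{m\times k}$, $C\in\mathbb{Z}_h^{k\times n}$; $\rho(0)=0$. -}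

module Defs where

open import Data.Nat as ℕ using (ℕ; zero; suc; _^_)
open import Data.Integer as ℤ using (ℤ; +_; _-_)
open import Data.Integer.Divisibility using (_∣_)
open import Data.Fin using (Fin; zero; suc; toℕ; fromℕ; inject₁)
open import Data.Product using (Σ; _×_)
open import Relation.Nullary using (¬_; yes; no)
open import Relation.Unary using (Pred; Decidable)
open import Function using (_∘_)
open import Level using (0ℓ)

-- Elements of ℤ_h are represented by integer representatives;
-- equality in ℤ_h is congruence modulo h.
_≡[mod_]_ : ℤ → ℕ → ℤ → Set
a ≡[mod h ] b = (+ h) ∣ (a - b)

sumFin : (k : ℕ) → (Fin k → ℤ) → ℤ
sumFin zero f = + 0
sumFin (suc k) f = f zero ℤ.+ sumFin k (f ∘ suc)

prodFin : (k : ℕ) → (Fin k → ℕ) → ℕ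
prodFin zero f = 1
prodFin (suc k) f = f zero ℕ.* prodFin k (f ∘ suc)

Mat : ℕ → ℕ → Set
Mat m n = Fin m → Fin n → ℤ

_*M_ : ∀ {m k n} → Mat m k → Mat k n → Mat m n
_*M_ {k = k} B C i j = sumFin k (λ l → B i l ℤ.* C l j)

MatEq : ℕ → ∀ {m n} → Mat m n → Mat m n → Set
MatEq h A B = ∀ i j → A i j ≡[mod h ] B i j

I : ∀ {m} → Mat m m
I i j with toℕ i ℕ.≟ toℕ j
... | yes _ = + 1
... | no _ = + 0

IsInvertible : ℕ → ∀ {m} → Mat m m → Set
IsInvertible h {m} S = Σ (Mat m m) λ S' → MatEq h (S *M S') I × MatEq h (S' *M S) I

diag : ∀ {m n} → (Fin m → ℤ) → Mat m n
diag d i j with toℕ i ℕ.≟ toℕ j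
... | yes _ = d i
... | no _ = + 0

HasFactorization : ℕ → ∀ {m n} → Mat m n → ℕ → Set
HasFactorization h {m} {n} A k =
  Σ (Mat m k) λ B → Σ (Mat k n) λ C → MatEq h A (B *M C)

-- ρ(A) = r : r is the least k with a factorization A = B C, B : m×k, C : k×n
-- (for A = 0 this gives 0, matching ρ(0) = 0)
InnerRank : ℕ → ∀ {m n} → Mat m n → ℕ → Set
InnerRank h A r = HasFactorization h A r × (∀ k → k ℕ.< r → ¬ HasFactorization h A k)

-- max { c ∈ {1,…,m} : P (c-1) }, with max ∅ = 0  (index c ↔ Fin element c-1)
maxWhere : ∀ {m} (P : Pred (Fin m) 0ℓ) → Decidable P → ℕ
maxWhere {zero} P d = 0
maxWhere {suc m} P d with d (fromℕ m)
... | yes _ = suc m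
... | no _ = maxWhere (P ∘ inject₁) (d ∘ inject₁)

module Submission where

open import Defs
open import Data.Nat using (ℕ; _^_; _≤_; _<_)
open import Data.Integer using (+_)
open import Data.Fin using (Fin; toℕ)
open import Data.Fin.Properties using (all?)
open import Data.Nat.Primality using (Prime)
open import Relation.Binary.PropositionalEquality using (_≡_)
open import Relation.Nullary using (¬_; ¬?)
open import Data.Nat.Properties using (_≟_)

-- Write d c = ∏ᵢ pᵢ ^ αᵢc and r for the claimed rank. For c ≥ r the entry d c is h itself, so the
-- columns of S D beyond r vanish mod h and A ≡ (first r columns of S D) (first r rows of T).
-- Conversely, let A ≡ B C with k < r columns in B. By the choice of r some exponent αᵢ,r−1 is below
-- sᵢ; put q = pᵢ. The integer system C x = 0, (T x)ₗ = 0 for l ≥ r has k + (n − r) < n equations,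
-- so it has a solution x not divisible by q. Then y = T x is supported on the first r indices and
-- D y ≡ S⁻¹ A x ≡ S⁻¹ B C x ≡ 0 (mod h). By monotonicity each d c with c < r has q-adic valuation
-- below that of h, so q divides y, and then also x ≡ T⁻¹ y (mod q): a contradiction.

module Sums where
  open import Data.Nat using (zero; suc)
  open import Data.Integer using (ℤ; _+_; _*_)
  open import Data.Integer.Properties
    using (*-zeroʳ; *-zeroˡ; +-identityˡ; +-identityʳ; *-distribˡ-+; *-distribʳ-+)
  open import Data.Integer.Tactic.RingSolver using (solve-∀)
  open import Data.Fin using (zero; suc)
  open import Data.Fin.Properties using (suc-injective)
  open import Function using (_∘_)
  open import Relation.Binary.PropositionalEquality using (refl; sym; trans; cong; cong₂; _≢_)

  sumFin-cong : ∀ k {f g : Fin k → ℤ} → (∀ l → f l ≡ g l) → sumFin k f ≡ sumFin k g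
  sumFin-cong zero    f≡g = refl
  sumFin-cong (suc k) f≡g = cong₂ _+_ (f≡g zero) (sumFin-cong k (f≡g ∘ suc))

  sumFin-zero : ∀ k {f : Fin k → ℤ} → (∀ l → f l ≡ + 0) → sumFin k f ≡ + 0
  sumFin-zero zero    f≡0 = refl
  sumFin-zero (suc k) f≡0 = cong₂ _+_ (f≡0 zero) (sumFin-zero k (f≡0 ∘ suc))

  sumFin-+ : ∀ k (f g : Fin k → ℤ) → sumFin k (λ l → f l + g l) ≡ sumFin k f + sumFin k g
  sumFin-+ zero    f g = refl
  sumFin-+ (suc k) f g =
    trans (cong (_+_ (f zero + g zero)) (sumFin-+ k (f ∘ suc) (g ∘ suc)))
          (interchange (f zero) (g zero) (sumFin k (f ∘ suc)) (sumFin k (g ∘ suc)))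
    where
    interchange : ∀ a b c d → (a + b) + (c + d) ≡ (a + c) + (b + d)
    interchange = solve-∀

  sumFin-*ˡ : ∀ k c (f : Fin k → ℤ) → sumFin k (λ l → c * f l) ≡ c * sumFin k f
  sumFin-*ˡ zero    c f = sym (*-zeroʳ c)
  sumFin-*ˡ (suc k) c f =
    trans (cong (_+_ (c * f zero)) (sumFin-*ˡ k c (f ∘ suc))) (sym (*-distribˡ-+ c (f zero) _))

  sumFin-*ʳ : ∀ k c (f : Fin k → ℤ) → sumFin k (λ l → f l * c) ≡ sumFin k f * c
  sumFin-*ʳ zero    c f = sym (*-zeroˡ c)
  sumFin-*ʳ (suc k) c f =
    trans (cong (_+_ (f zero * c)) (sumFin-*ʳ k c (f ∘ suc))) (sym (*-distribʳ-+ c (f zero) _))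

  sumFin-swap : ∀ a b (f : Fin a → Fin b → ℤ) →
    sumFin a (λ i → sumFin b (f i)) ≡ sumFin b (λ j → sumFin a (λ i → f i j))
  sumFin-swap zero    b f = sym (sumFin-zero b (λ _ → refl))
  sumFin-swap (suc a) b f =
    trans (cong (_+_ (sumFin b (f zero))) (sumFin-swap a b (f ∘ suc)))
          (sym (sumFin-+ b (f zero) (λ j → sumFin a (λ i → f (suc i) j))))

  sumFin-single : ∀ k {f : Fin k → ℤ} (i : Fin k) → (∀ l → l ≢ i → f l ≡ + 0) → sumFin k f ≡ f i
  sumFin-single (suc k) {f} zero    f≡0 =
    trans (cong (_+_ (f zero)) (sumFin-zero k (λ l → f≡0 (suc l) (λ ())))) (+-identityʳ (f zero))
  sumFin-single (suc k) {f} (suc i) f≡0 =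
    trans (cong₂ _+_ (f≡0 zero (λ ())) (sumFin-single k i (λ l l≢i → f≡0 (suc l) (l≢i ∘ suc-injective))))
          (+-identityˡ (f (suc i)))

module Congruence where
  open import Data.Nat using (zero; suc)
  open import Data.Nat.Divisibility using () renaming (_∣_ to _∣ℕ_)
  open import Data.Integer using (ℤ; _+_; _*_; -_; _-_)
  open import Data.Integer.Properties using (+-identityʳ)
  open import Data.Integer.Divisibility.Signed
    using (_∣_; divides; ∣ᵤ⇒∣; ∣⇒∣ᵤ; ∣-trans; ∣m∣n⇒∣m+n; ∣m⇒∣-m; ∣n⇒∣m*n)
  open import Data.Integer.Tactic.RingSolver using (solve-∀)
  open import Data.Fin using (zero; suc)
  open import Function using (_∘_)
  open import Relation.Binary.Bundles using (Setoid)
  open import Relation.Binary.Structures using (IsEquivalence)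
  open import Relation.Binary.PropositionalEquality using (refl; sym; subst)

  -- A record rather than a synonym for `+ h ∣ a - b`, so that `a` and `b` are inferable.
  infix 4 _≈[_]_
  record _≈[_]_ (a : ℤ) (h : ℕ) (b : ℤ) : Set where
    constructor mk
    field ∣-difference : + h ∣ a - b

  MatEq⇒≈ : ∀ {h m n} {M N : Mat m n} → MatEq h M N → ∀ i j → M i j ≈[ h ] N i j
  MatEq⇒≈ M≡N i j = mk (∣ᵤ⇒∣ (M≡N i j))

  ≈⇒≡[mod] : ∀ {h a b} → a ≈[ h ] b → a ≡[mod h ] b
  ≈⇒≡[mod] (mk h∣a-b) = ∣⇒∣ᵤ h∣a-b

  ∣⇒≈0 : ∀ {h a} → + h ∣ a → a ≈[ h ] + 0
  ∣⇒≈0 {a = a} h∣a = mk (subst (_ ∣_) (sym (+-identityʳ a)) h∣a)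

  ≈0⇒∣ : ∀ {h a} → a ≈[ h ] + 0 → + h ∣ a
  ≈0⇒∣ {a = a} (mk h∣a-0) = subst (_ ∣_) (+-identityʳ a) h∣a-0

  ≈-reflexive : ∀ {h a b} → a ≡ b → a ≈[ h ] b
  ≈-reflexive {a = a} refl = mk (subst (_ ∣_) (sym (a-a≡0 a)) (divides (+ 0) refl))
    where
    a-a≡0 : ∀ a → a - a ≡ + 0
    a-a≡0 = solve-∀

  ≈-sym : ∀ {h a b} → a ≈[ h ] b → b ≈[ h ] a
  ≈-sym {a = a} {b} (mk h∣a-b) = mk (subst (_ ∣_) (negate a b) (∣m⇒∣-m h∣a-b))
    where
    negate : ∀ a b → - (a - b) ≡ b - a
    negate = solve-∀

  ≈-trans : ∀ {h a b c} → a ≈[ h ] b → b ≈[ h ] c → a ≈[ h ] c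
  ≈-trans {a = a} {b} {c} (mk h∣a-b) (mk h∣b-c) =
    mk (subst (_ ∣_) (telescope a b c) (∣m∣n⇒∣m+n h∣a-b h∣b-c))
    where
    telescope : ∀ a b c → (a - b) + (b - c) ≡ a - c
    telescope = solve-∀

  ≈-isEquivalence : ∀ h → IsEquivalence (λ a b → a ≈[ h ] b)
  ≈-isEquivalence h = record { refl = ≈-reflexive refl ; sym = ≈-sym ; trans = ≈-trans }

  ≈-setoid : ℕ → Setoid _ _
  ≈-setoid h = record { isEquivalence = ≈-isEquivalence h }

  module ≈-Reasoning (h : ℕ) where
    open import Relation.Binary.Reasoning.Setoid (≈-setoid h) public

  ≈-weaken : ∀ {q h a b} → q ∣ℕ h → a ≈[ h ] b → a ≈[ q ] b
  ≈-weaken {q} {h} q∣h (mk h∣a-b) = mk (∣-trans (∣ᵤ⇒∣ {+ q} {+ h} q∣h) h∣a-b)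

  +-cong : ∀ {h a b c d} → a ≈[ h ] b → c ≈[ h ] d → a + c ≈[ h ] b + d
  +-cong {a = a} {b} {c} {d} (mk h∣a-b) (mk h∣c-d) =
    mk (subst (_ ∣_) (regroup a b c d) (∣m∣n⇒∣m+n h∣a-b h∣c-d))
    where
    regroup : ∀ a b c d → (a - b) + (c - d) ≡ (a + c) - (b + d)
    regroup = solve-∀

  *-congˡ : ∀ {h a b} c → a ≈[ h ] b → c * a ≈[ h ] c * b
  *-congˡ {a = a} {b} c (mk h∣a-b) = mk (subst (_ ∣_) (distrib c a b) (∣n⇒∣m*n c h∣a-b))
    where
    distrib : ∀ c a b → c * (a - b) ≡ c * a - c * b
    distrib = solve-∀

  *-congʳ : ∀ {h a b} c → a ≈[ h ] b → a * c ≈[ h ] b * c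
  *-congʳ {a = a} {b} c (mk h∣a-b) = mk (subst (_ ∣_) (distrib c a b) (∣n⇒∣m*n c h∣a-b))
    where
    distrib : ∀ c a b → c * (a - b) ≡ a * c - b * c
    distrib = solve-∀

  sumFin-cong-≈ : ∀ {h} k {f g : Fin k → ℤ} → (∀ l → f l ≈[ h ] g l) → sumFin k f ≈[ h ] sumFin k g
  sumFin-cong-≈ zero    f≈g = ≈-reflexive refl
  sumFin-cong-≈ (suc k) f≈g = +-cong (f≈g zero) (sumFin-cong-≈ k (f≈g ∘ suc))

module Matrices where
  open import Data.Nat using (zero; suc; z≤n; s≤s)
  open import Data.Nat.Properties using (≤-pred)
  open import Data.Nat.Divisibility using () renaming (_∣_ to _∣ℕ_)
  open import Data.Integer using (ℤ; _+_; _*_)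
  open import Data.Integer.Properties using (*-zeroˡ; *-zeroʳ; *-identityˡ; *-assoc)
  open import Data.Integer.Divisibility.Signed using (_∣_; divides; ∣m∣n⇒∣m+n; ∣n⇒∣m*n)
  open import Data.Fin using (zero; suc; inject≤)
  open import Data.Fin.Properties using (toℕ-injective; toℕ-inject≤)
  open import Data.Empty using (⊥-elim)
  open import Function using (_∘_)
  open import Relation.Nullary using (yes; no)
  open import Relation.Binary.PropositionalEquality
    using (refl; sym; trans; subst; _≢_; module ≡-Reasoning)
  open Sums
  open Congruence

  infixl 7 _*ᵥ_
  _*ᵥ_ : ∀ {m n} → Mat m n → (Fin n → ℤ) → Fin m → ℤ
  (M *ᵥ x) i = sumFin _ (λ l → M i l * x l)

  *M-*ᵥ-assoc : ∀ {m k n} (B : Mat m k) (C : Mat k n) (x : Fin n → ℤ) i →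
    (B *M C *ᵥ x) i ≡ (B *ᵥ (C *ᵥ x)) i
  *M-*ᵥ-assoc {k = k} {n} B C x i = begin
    sumFin n (λ l → sumFin k (λ j → B i j * C j l) * x l)
      ≡⟨ sumFin-cong n (λ l → sym (sumFin-*ʳ k (x l) (λ j → B i j * C j l))) ⟩
    sumFin n (λ l → sumFin k (λ j → B i j * C j l * x l))
      ≡⟨ sumFin-swap n k _ ⟩
    sumFin k (λ j → sumFin n (λ l → B i j * C j l * x l))
      ≡⟨ sumFin-cong k (λ j → sumFin-cong n (λ l → *-assoc (B i j) (C j l) (x l))) ⟩
    sumFin k (λ j → sumFin n (λ l → B i j * (C j l * x l)))
      ≡⟨ sumFin-cong k (λ j → sumFin-*ˡ n (B i j) _) ⟩
    sumFin k (λ j → B i j * sumFin n (λ l → C j l * x l)) ∎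
    where open ≡-Reasoning

  I-*ᵥ : ∀ {m} (x : Fin m → ℤ) i → (I *ᵥ x) i ≡ x i
  I-*ᵥ {m} x i = trans (sumFin-single m i off-diagonal) on-diagonal
    where
    off-diagonal : ∀ l → l ≢ i → I i l * x l ≡ + 0
    off-diagonal l l≢i with toℕ i ≟ toℕ l
    ... | yes i≡l = ⊥-elim (l≢i (toℕ-injective (sym i≡l)))
    ... | no _    = *-zeroˡ (x l)
    on-diagonal : I i i * x i ≡ x i
    on-diagonal with toℕ i ≟ toℕ i
    ... | yes _  = *-identityˡ (x i)
    ... | no i≢i = ⊥-elim (i≢i refl)

  diag-*ᵥ : ∀ {m n} (m≤n : m ≤ n) (d : Fin m → ℤ) (y : Fin n → ℤ) c →
    (diag d *ᵥ y) c ≡ d c * y (inject≤ c m≤n)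
  diag-*ᵥ {n = n} m≤n d y c = trans (sumFin-single n (inject≤ c m≤n) off-diagonal) on-diagonal
    where
    off-diagonal : ∀ l → l ≢ inject≤ c m≤n → diag d c l * y l ≡ + 0
    off-diagonal l l≢c with toℕ c ≟ toℕ l
    ... | yes c≡l = ⊥-elim (l≢c (toℕ-injective (trans (sym c≡l) (sym (toℕ-inject≤ c m≤n)))))
    ... | no _    = *-zeroˡ (y l)
    on-diagonal : diag d c (inject≤ c m≤n) * y (inject≤ c m≤n) ≡ d c * y (inject≤ c m≤n)
    on-diagonal with toℕ c ≟ toℕ (inject≤ c m≤n)
    ... | yes _  = refl
    ... | no c≢c = ⊥-elim (c≢c (sym (toℕ-inject≤ c m≤n)))

  *ᵥ-congˡ : ∀ {h m n} {M N : Mat m n} → MatEq h M N → ∀ x i → (M *ᵥ x) i ≈[ h ] (N *ᵥ x) i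
  *ᵥ-congˡ {n = n} {M} {N} M≡N x i =
    sumFin-cong-≈ n (λ l → *-congʳ (x l) (MatEq⇒≈ {M = M} {N} M≡N i l))

  *ᵥ-congʳ : ∀ {h m n} (M : Mat m n) {x y : Fin n → ℤ} → (∀ l → x l ≈[ h ] y l) →
    ∀ i → (M *ᵥ x) i ≈[ h ] (M *ᵥ y) i
  *ᵥ-congʳ {n = n} M x≈y i = sumFin-cong-≈ n (λ l → *-congˡ (M i l) (x≈y l))

  left-inverse-*ᵥ : ∀ {h m} (S S' : Mat m m) → MatEq h (S' *M S) I →
    ∀ x i → x i ≈[ h ] (S' *ᵥ (S *ᵥ x)) i
  left-inverse-*ᵥ {h} S S' S'S≡I x i = begin
    x i                  ≡⟨ sym (I-*ᵥ x i) ⟩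
    (I *ᵥ x) i           ≈⟨ *ᵥ-congˡ {M = S' *M S} {I} S'S≡I x i ⟨
    (S' *M S *ᵥ x) i     ≡⟨ *M-*ᵥ-assoc S' S x i ⟩
    (S' *ᵥ (S *ᵥ x)) i   ∎
    where open ≈-Reasoning h

  *ᵥ≈0⇒≈0 : ∀ {q h m} (S S' : Mat m m) → q ∣ℕ h → MatEq h (S' *M S) I →
    ∀ z → (∀ i → (S *ᵥ z) i ≈[ q ] + 0) → ∀ c → z c ≈[ q ] + 0
  *ᵥ≈0⇒≈0 {q} {m = m} S S' q∣h S'S≡I z Sz≈0 c = begin
    z c                    ≈⟨ ≈-weaken q∣h (left-inverse-*ᵥ S S' S'S≡I z c) ⟩
    (S' *ᵥ (S *ᵥ z)) c     ≈⟨ *ᵥ-congʳ S' Sz≈0 c ⟩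
    (S' *ᵥ (λ _ → + 0)) c  ≡⟨ sumFin-zero m (λ l → *-zeroʳ (S' c l)) ⟩
    + 0                    ∎
    where open ≈-Reasoning q

  sumFin-∣ : ∀ {h} k {f : Fin k → ℤ} → (∀ l → + h ∣ f l) → + h ∣ sumFin k f
  sumFin-∣ zero    h∣f = divides (+ 0) refl
  sumFin-∣ (suc k) h∣f = ∣m∣n⇒∣m+n (h∣f zero) (sumFin-∣ k (h∣f ∘ suc))

  sumFin-truncate : ∀ {h r n} (r≤n : r ≤ n) (f : Fin n → ℤ) → (∀ l → r ≤ toℕ l → + h ∣ f l) →
    sumFin n f ≈[ h ] sumFin r (λ l → f (inject≤ l r≤n))
  sumFin-truncate {r = zero}  {n}     z≤n f h∣tail = ∣⇒≈0 (sumFin-∣ n (λ l → h∣tail l z≤n))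
  sumFin-truncate {r = suc r} {suc n} r≤n f h∣tail =
    +-cong (≈-reflexive {a = f zero} refl)
           (sumFin-truncate (≤-pred r≤n) (f ∘ suc) (λ l r≤l → h∣tail (suc l) (s≤s r≤l)))

  *M-diag-∣ : ∀ {h k m n r} (M : Mat k m) (d : Fin m → ℤ) → (∀ c → r ≤ toℕ c → + h ∣ d c) →
    ∀ i (l : Fin n) → r ≤ toℕ l → + h ∣ (M *M diag d) i l
  *M-diag-∣ {m = m} {r = r} M d h∣d i l r≤l = sumFin-∣ m term-∣
    where
    term-∣ : ∀ c → + _ ∣ M i c * diag d c l
    term-∣ c with toℕ c ≟ toℕ l
    ... | yes c≡l = ∣n⇒∣m*n (M i c) (h∣d c (subst (r ≤_) (sym c≡l) r≤l))
    ... | no _    = subst (_ ∣_) (sym (*-zeroʳ (M i c))) (divides (+ 0) refl)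

module IntegerKernel where
  open import Data.Nat as ℕ using (zero; suc; z≤n; s≤s; _∸_; ≢-nonZero)
  open import Data.Nat.Properties
    using (<-≤-trans; ≤-pred; ≤-refl; m<m*n; <⇒≢; +-monoʳ-<; +-monoˡ-<; m+[n∸m]≡n; ∸-monoˡ-<)
  open import Data.Integer using (ℤ; _+_; _*_; -_; _-_; ∣_∣) renaming (_≟_ to _≟ℤ_)
  open import Data.Integer.Properties
    using (*-zeroʳ; *-identityʳ; *-assoc; +-inverseʳ; i*j≡0⇒i≡0∨j≡0; abs-*; ∣i∣≡0⇒i≡0; +-injective)
  open import Data.Integer.Divisibility.Signed using (_∣_; _∣?_; module _∣_)
  open import Data.Integer.Tactic.RingSolver using (solve-∀)
  open import Data.Fin using (zero; suc; punchIn; punchOut; fromℕ<; splitAt; _↑ˡ_; _↑ʳ_)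
  open import Data.Fin.Properties
    using (any?; punchIn-punchOut; toℕ<n; toℕ-fromℕ<; toℕ-injective; splitAt-↑ˡ; splitAt-↑ʳ)
    renaming (_≟_ to _≟ᶠ_)
  open import Data.Product using (∃-syntax; _×_; _,_; proj₁; proj₂)
  open import Data.Sum using ([_,_]′)
  open import Data.Empty using (⊥-elim)
  open import Function using (_∘_)
  open import Relation.Nullary using (yes; no)
  open import Relation.Nullary.Decidable using (decidable-stable)
  open import Relation.Binary.PropositionalEquality
    using (refl; sym; trans; cong; cong₂; subst; _≢_; module ≡-Reasoning)
  open Sums
  open Matrices using (_*ᵥ_)

  ∃-nonzero-kernel-vector : ∀ {N n} → N < n → (L : Mat N n) →
    ∃[ x ] (∃[ l ] x l ≢ + 0) × (∀ i → (L *ᵥ x) i ≡ + 0)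
  ∃-nonzero-kernel-vector {N} {suc n} N<n L with any? (λ i → ¬? (L i zero ≟ℤ + 0))
  ... | no first-column-zero = e₀ , (zero , λ ()) , Le₀≡0
    where
    e₀ : Fin (suc n) → ℤ
    e₀ zero    = + 1
    e₀ (suc l) = + 0
    Le₀≡0 : ∀ i → (L *ᵥ e₀) i ≡ + 0
    Le₀≡0 i = cong₂ _+_
      (trans (*-identityʳ (L i zero))
             (decidable-stable (L i zero ≟ℤ + 0) (λ Li0≢0 → first-column-zero (i , Li0≢0))))
      (sumFin-zero n (λ l → *-zeroʳ (L i (suc l))))
  ∃-nonzero-kernel-vector {suc N} {suc n} (s≤s N<n) L | yes (i₀ , a≢0) = x , x≢0 , Lx≡0
    where
    a = L i₀ zero
    -- One step of Gaussian elimination, pivoting on the nonzero entry a of the first column.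
    L' : Mat N n
    L' j l = a * L (punchIn i₀ j) (suc l) - L (punchIn i₀ j) zero * L i₀ (suc l)
    solution = ∃-nonzero-kernel-vector N<n L'
    y = proj₁ solution
    x : Fin (suc n) → ℤ
    x zero    = - sumFin n (λ l → L i₀ (suc l) * y l)
    x (suc l) = a * y l
    x≢0 : ∃[ l ] x l ≢ + 0
    x≢0 with proj₁ (proj₂ solution)
    ... | l , yl≢0 = suc l , [ a≢0 , yl≢0 ]′ ∘ i*j≡0⇒i≡0∨j≡0 a
    eliminated : ∀ i → (L *ᵥ x) i ≡ sumFin n (λ l → (a * L i (suc l) - L i zero * L i₀ (suc l)) * y l)
    eliminated i = begin
      c * (- Σby) + Σuay                   ≡⟨ rearrange c Σby Σuay ⟩
      Σuay + - c * Σby                     ≡⟨ cong (_+_ Σuay) (sym (sumFin-*ˡ n (- c) by)) ⟩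
      Σuay + sumFin n (λ l → - c * by l)   ≡⟨ sym (sumFin-+ n uay (λ l → - c * by l)) ⟩
      sumFin n (λ l → uay l + - c * by l)
        ≡⟨ sumFin-cong n (λ l → pointwise a c (L i (suc l)) (L i₀ (suc l)) (y l)) ⟩
      sumFin n (λ l → (a * L i (suc l) - c * L i₀ (suc l)) * y l) ∎
      where
      open ≡-Reasoning
      c = L i zero
      by = λ l → L i₀ (suc l) * y l
      uay = λ l → L i (suc l) * (a * y l)
      Σby = sumFin n by
      Σuay = sumFin n uay
      rearrange : ∀ c s t → c * (- s) + t ≡ t + - c * s
      rearrange = solve-∀
      pointwise : ∀ a c u b y → u * (a * y) + - c * (b * y) ≡ (a * u - c * b) * y
      pointwise = solve-∀
    Lx≡0 : ∀ i → (L *ᵥ x) i ≡ + 0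
    Lx≡0 i with i ≟ᶠ i₀
    ... | yes refl = trans (eliminated i₀)
                       (sumFin-zero n (λ l → cong (_* y l) (+-inverseʳ (a * L i₀ (suc l)))))
    ... | no i≢i₀  = trans (eliminated i)
      (subst (λ i → sumFin n (λ l → (a * L i (suc l) - L i zero * L i₀ (suc l)) * y l) ≡ + 0)
             (punchIn-punchOut (i≢i₀ ∘ sym)) (proj₂ (proj₂ solution) (punchOut (i≢i₀ ∘ sym))))

  *ᵥ-*ʳ : ∀ {N n} (L : Mat N n) (x : Fin n → ℤ) c i → (L *ᵥ x) i * c ≡ (L *ᵥ (λ l → x l * c)) i
  *ᵥ-*ʳ {n = n} L x c i =
    trans (sym (sumFin-*ʳ n c (λ l → L i l * x l))) (sumFin-cong n (λ l → *-assoc (L i l) (x l) c))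

  -- The fuel b bounds ∣ x l ∣, which strictly decreases each time x is divided by q.
  kernel-vector-not-divisible : ∀ {N n q} → 1 < q → (L : Mat N n) (b : ℕ) (x : Fin n → ℤ) (l : Fin n) →
    ∣ x l ∣ < b → x l ≢ + 0 → (∀ i → (L *ᵥ x) i ≡ + 0) →
    ∃[ x' ] ¬ (∀ l → + q ∣ x' l) × (∀ i → (L *ᵥ x') i ≡ + 0)
  kernel-vector-not-divisible {n = n} {q} 1<q L (suc b) x l ∣xl∣<b xl≢0 Lx≡0
    with all? (λ l → + q ∣? x l)
  ... | no ¬q∣x = x , ¬q∣x , Lx≡0
  ... | yes q∣x = kernel-vector-not-divisible 1<q L b x' l ∣x'l∣<b x'l≢0 Lx'≡0
    where
    x' : Fin n → ℤ
    x' l = _∣_.quotient (q∣x l)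
    x≡x'q : ∀ l → x l ≡ x' l * + q
    x≡x'q l = _∣_.equality (q∣x l)
    q≢0 : + q ≢ + 0
    q≢0 q≡0 = <⇒≢ (<-≤-trans (s≤s z≤n) 1<q) (sym (+-injective q≡0))
    x'l≢0 : x' l ≢ + 0
    x'l≢0 x'l≡0 = xl≢0 (trans (x≡x'q l) (cong (_* + q) x'l≡0))
    Lx'≡0 : ∀ i → (L *ᵥ x') i ≡ + 0
    Lx'≡0 i = [ (λ Lx'≡0 → Lx'≡0) , ⊥-elim ∘ q≢0 ]′ (i*j≡0⇒i≡0∨j≡0 _
      (trans (*ᵥ-*ʳ L x' (+ q) i)
             (trans (sumFin-cong n (λ l → cong (L i l *_) (sym (x≡x'q l)))) (Lx≡0 i))))
    ∣x'l∣<b : ∣ x' l ∣ < b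
    ∣x'l∣<b = <-≤-trans (m<m*n ∣ x' l ∣ q {{≢-nonZero (x'l≢0 ∘ ∣i∣≡0⇒i≡0)}} 1<q)
      (≤-pred (subst (_< suc b) (trans (cong ∣_∣ (x≡x'q l)) (abs-* (x' l) (+ q))) ∣xl∣<b))

  ∃-kernel-vector-not-divisible : ∀ {N n q} → 1 < q → N < n → (L : Mat N n) →
    ∃[ x ] ¬ (∀ l → + q ∣ x l) × (∀ i → (L *ᵥ x) i ≡ + 0)
  ∃-kernel-vector-not-divisible 1<q N<n L with ∃-nonzero-kernel-vector N<n L
  ... | x , (l , xl≢0) , Lx≡0 = kernel-vector-not-divisible 1<q L (suc ∣ x l ∣) x l ≤-refl xl≢0 Lx≡0

  offset : ∀ {r n} → r ≤ n → Fin (n ∸ r) → Fin n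
  offset {r} r≤n j = fromℕ< (subst (r ℕ.+ toℕ j <_) (m+[n∸m]≡n r≤n) (+-monoʳ-< r (toℕ<n j)))

  offset-onto : ∀ {r n} (r≤n : r ≤ n) (l : Fin n) → r ≤ toℕ l → ∃[ j ] offset r≤n j ≡ l
  offset-onto {r} r≤n l r≤l = j , toℕ-injective (begin
    toℕ (offset r≤n j)     ≡⟨ toℕ-fromℕ< _ ⟩
    r ℕ.+ toℕ j            ≡⟨ cong (r ℕ.+_) (toℕ-fromℕ< _) ⟩
    r ℕ.+ (toℕ l ∸ r)      ≡⟨ m+[n∸m]≡n r≤l ⟩
    toℕ l                  ∎)
    where
    open ≡-Reasoning
    j = fromℕ< (∸-monoˡ-< (toℕ<n l) r≤l)

  ∃-kernel-vector-with-vanishing-tail : ∀ {k r n q} → 1 < q → k < r → (r≤n : r ≤ n) →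
    (C : Mat k n) (T : Mat n n) →
    ∃[ x ] ¬ (∀ l → + q ∣ x l) × (∀ j → (C *ᵥ x) j ≡ + 0) × (∀ l → r ≤ toℕ l → (T *ᵥ x) l ≡ + 0)
  ∃-kernel-vector-with-vanishing-tail {k} {r} {n} 1<q k<r r≤n C T
    with ∃-kernel-vector-not-divisible 1<q
           (subst (k ℕ.+ (n ∸ r) <_) (m+[n∸m]≡n r≤n) (+-monoˡ-< (n ∸ r) k<r))
           (λ i → [ C , T ∘ offset r≤n ]′ (splitAt k i))
  ... | x , ¬q∣x , Lx≡0 = x , ¬q∣x , Cx≡0 , Tx≡0
    where
    row≡0 : ∀ i {row} → [ C , T ∘ offset r≤n ]′ (splitAt k i) ≡ row → sumFin n (λ l → row l * x l) ≡ + 0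
    row≡0 i refl = Lx≡0 i
    Cx≡0 : ∀ j → (C *ᵥ x) j ≡ + 0
    Cx≡0 j = row≡0 (j ↑ˡ (n ∸ r)) (cong [ C , T ∘ offset r≤n ]′ (splitAt-↑ˡ k j (n ∸ r)))
    Tx≡0 : ∀ l → r ≤ toℕ l → (T *ᵥ x) l ≡ + 0
    Tx≡0 l r≤l with offset-onto r≤n l r≤l
    ... | j , refl = row≡0 (k ↑ʳ j) (cong [ C , T ∘ offset r≤n ]′ (splitAt-↑ʳ k (n ∸ r) j))

module InnerRankBounds where
  open import Data.Nat.Properties using (≤-trans; <-≤-trans; ≮⇒≥; _<?_)
  open import Data.Nat.Divisibility using (∣-refl) renaming (_∣_ to _∣ℕ_)
  open import Data.Integer using (ℤ; _*_)
  open import Data.Integer.Properties using (*-zeroʳ)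
  open import Data.Integer.Divisibility.Signed using (_∣_; divides; ∣m⇒∣m*n)
  open import Data.Fin using (fromℕ<; inject≤)
  open import Data.Fin.Properties using (toℕ-injective; toℕ-inject≤; toℕ-fromℕ<)
  open import Data.Product using (_,_)
  open import Function using (_∘_)
  open import Relation.Nullary using (yes; no)
  open import Relation.Binary.PropositionalEquality using (refl; sym; trans; cong; subst)
  open Sums
  open Congruence
  open Matrices
  open IntegerKernel

  hasFactorization-truncate : ∀ {h m n r} {A : Mat m n} (S : Mat m m) (d : Fin m → ℤ) (T : Mat n n) →
    r ≤ n → (∀ c → r ≤ toℕ c → + h ∣ d c) → MatEq h A ((S *M diag d) *M T) → HasFactorization h A r
  hasFactorization-truncate {A = A} S d T r≤n h∣d A≡SDT =
    (λ i l → (S *M diag d) i (inject≤ l r≤n)) , (λ l → T (inject≤ l r≤n)) , λ i j →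
    ≈⇒≡[mod] (≈-trans (MatEq⇒≈ {M = A} A≡SDT i j)
      (sumFin-truncate r≤n _ (λ l r≤l → ∣m⇒∣m*n (T l j) (*M-diag-∣ S d h∣d i l r≤l))))

  no-factorization-below : ∀ {h q m n r k} {A : Mat m n} {S S' : Mat m m} {T T' : Mat n n}
    (d : Fin m → ℤ) → 1 < q → q ∣ℕ h → r ≤ m → m ≤ n →
    MatEq h (S' *M S) I → MatEq h (T' *M T) I → MatEq h A ((S *M diag d) *M T) →
    (∀ c → toℕ c < r → ∀ y → + h ∣ d c * y → + q ∣ y) →
    k < r → ¬ HasFactorization h A k
  no-factorization-below {h} {q} {m} {n} {r} {k} {A} {S} {S'} {T} {T'} d
    1<q q∣h r≤m m≤n S'S≡I T'T≡I A≡SDT d-regular k<r (B , C , A≡BC)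
    with ∃-kernel-vector-with-vanishing-tail 1<q k<r (≤-trans r≤m m≤n) C T
  ... | x , ¬q∣x , Cx≡0 , Tx-tail≡0 = ¬q∣x q∣x
    where
    y = T *ᵥ x
    SDy≈0 : ∀ i → (S *ᵥ (diag d *ᵥ y)) i ≈[ h ] + 0
    SDy≈0 i = begin
      (S *ᵥ (diag d *ᵥ y)) i           ≡⟨ *M-*ᵥ-assoc S (diag d) y i ⟨
      (S *M diag d *ᵥ y) i             ≡⟨ *M-*ᵥ-assoc (S *M diag d) T x i ⟨
      ((S *M diag d) *M T *ᵥ x) i      ≈⟨ *ᵥ-congˡ {M = A} A≡SDT x i ⟨
      (A *ᵥ x) i                       ≈⟨ *ᵥ-congˡ {M = A} A≡BC x i ⟩
      (B *M C *ᵥ x) i                  ≡⟨ *M-*ᵥ-assoc B C x i ⟩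
      (B *ᵥ (C *ᵥ x)) i
        ≡⟨ sumFin-zero k (λ j → trans (cong (B i j *_) (Cx≡0 j)) (*-zeroʳ (B i j))) ⟩
      + 0                              ∎
      where open ≈-Reasoning h
    q∣y : ∀ l → + q ∣ y l
    q∣y l with toℕ l <? r
    ... | no l≮r  = subst (_ ∣_) (sym (Tx-tail≡0 l (≮⇒≥ l≮r))) (divides (+ 0) refl)
    ... | yes l<r = d-regular c (subst (_< r) (sym (toℕ-fromℕ< _)) l<r) (y l)
                      (subst (_ ∣_) (trans (diag-*ᵥ m≤n d y c) (cong (λ l → d c * y l) c↦l))
                        (≈0⇒∣ (*ᵥ≈0⇒≈0 S S' ∣-refl S'S≡I (diag d *ᵥ y) SDy≈0 c)))
      where
      c = fromℕ< (<-≤-trans l<r r≤m)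
      c↦l : inject≤ c m≤n ≡ l
      c↦l = toℕ-injective (trans (toℕ-inject≤ c m≤n) (toℕ-fromℕ< _))
    q∣x : ∀ l → + q ∣ x l
    q∣x l = ≈0⇒∣ (*ᵥ≈0⇒≈0 T T' q∣h T'T≡I x (∣⇒≈0 ∘ q∣y) l)

module PrimePowers where
  open import Data.Nat using (zero; suc; _*_; _∸_; NonZero; nonTrivial⇒≢1)
  open import Data.Nat.Properties using (*-comm; *-assoc; ^-distribˡ-+-*; m^n≢0; m+[n∸m]≡n)
  open import Data.Nat.Divisibility using (_∣_; ∣-trans; ∣1⇒≡1; m∣m*n; ∣n⇒∣m*n; *-cancelˡ-∣)
  open import Data.Nat.Primality using (euclidsLemma; prime⇒irreducible; prime⇒nonTrivial; prime⇒nonZero)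
  open import Data.Fin using (zero; suc)
  open import Data.Fin.Properties using (suc-injective)
  open import Data.Product using (∃-syntax; _×_; _,_)
  open import Data.Sum using (inj₁; inj₂; [_,_]′)
  open import Data.Empty using (⊥-elim)
  open import Function using (_∘_)
  open import Relation.Binary.PropositionalEquality
    using (refl; sym; trans; cong; cong₂; subst; _≢_; module ≡-Reasoning)

  prodFin-cong : ∀ t {f g : Fin t → ℕ} → (∀ i → f i ≡ g i) → prodFin t f ≡ prodFin t g
  prodFin-cong zero    f≡g = refl
  prodFin-cong (suc t) f≡g = cong₂ _*_ (f≡g zero) (prodFin-cong t (f≡g ∘ suc))

  ∣-prodFin : ∀ t (f : Fin t → ℕ) i → f i ∣ prodFin t f
  ∣-prodFin (suc t) f zero    = m∣m*n (prodFin t (f ∘ suc))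
  ∣-prodFin (suc t) f (suc i) = ∣n⇒∣m*n (f zero) (∣-prodFin t (f ∘ suc) i)

  m∣m^n : ∀ m {n} → 1 ≤ n → m ∣ m ^ n
  m∣m^n m {suc n} _ = m∣m*n (m ^ n)

  ^-∣-cancel : ∀ {q} e s z .{{_ : NonZero q}} → e < s → q ^ s ∣ q ^ e * z → q ∣ z
  ^-∣-cancel {q} e s z e<s q^s∣q^e*z = *-cancelˡ-∣ (q ^ e) {{m^n≢0 q e}} (∣-trans q^e*q∣q^s q^s∣q^e*z)
    where
    q^s≡ : q ^ suc e * q ^ (s ∸ suc e) ≡ q ^ s
    q^s≡ = trans (sym (^-distribˡ-+-* q (suc e) (s ∸ suc e))) (cong (q ^_) (m+[n∸m]≡n e<s))
    q^e*q∣q^s : q ^ e * q ∣ q ^ s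
    q^e*q∣q^s = subst (_∣ q ^ s) (*-comm q (q ^ e)) (subst (q ^ suc e ∣_) q^s≡ (m∣m*n (q ^ (s ∸ suc e))))

  prime∤1 : ∀ {q} → Prime q → ¬ q ∣ 1
  prime∤1 q-prime q∣1 = nonTrivial⇒≢1 {{prime⇒nonTrivial q-prime}} (∣1⇒≡1 q∣1)

  prime∣^⇒∣ : ∀ {q} p e → Prime q → q ∣ p ^ e → q ∣ p
  prime∣^⇒∣ p zero    q-prime q∣1 = ⊥-elim (prime∤1 q-prime q∣1)
  prime∣^⇒∣ p (suc e) q-prime q∣p^e+1 =
    [ (λ q∣p → q∣p) , prime∣^⇒∣ p e q-prime ]′ (euclidsLemma p (p ^ e) q-prime q∣p^e+1)

  prime∤prime^ : ∀ {q p} e → Prime q → Prime p → q ≢ p → ¬ q ∣ p ^ e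
  prime∤prime^ {q} {p} e q-prime p-prime q≢p q∣p^e
    with prime⇒irreducible p-prime (prime∣^⇒∣ p e q-prime q∣p^e)
  ... | inj₁ q≡1 = nonTrivial⇒≢1 {{prime⇒nonTrivial q-prime}} q≡1
  ... | inj₂ q≡p = q≢p q≡p

  prime∤prodFin : ∀ {q} t (f : Fin t → ℕ) → Prime q → (∀ i → ¬ q ∣ f i) → ¬ q ∣ prodFin t f
  prime∤prodFin zero    f q-prime q∤f = prime∤1 q-prime
  prime∤prodFin (suc t) f q-prime q∤f q∣∏ =
    [ q∤f zero , prime∤prodFin t (f ∘ suc) q-prime (q∤f ∘ suc) ]′ (euclidsLemma _ _ q-prime q∣∏)

  prodFin-cofactor : ∀ {q} t (f : Fin t → ℕ) (i : Fin t) → Prime q → (∀ j → j ≢ i → ¬ q ∣ f j) →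
    ∃[ Q ] prodFin t f ≡ f i * Q × ¬ q ∣ Q
  prodFin-cofactor (suc t) f zero    q-prime q∤f =
    prodFin t (f ∘ suc) , refl , prime∤prodFin t (f ∘ suc) q-prime (λ j → q∤f (suc j) (λ ()))
  prodFin-cofactor {q} (suc t) f (suc i) q-prime q∤f
    with prodFin-cofactor t (f ∘ suc) i q-prime (λ j j≢i → q∤f (suc j) (j≢i ∘ suc-injective))
  ... | Q , ∏≡fi*Q , q∤Q = f zero * Q , ∏≡ , q∤f₀*Q
    where
    ∏≡ : f zero * prodFin t (f ∘ suc) ≡ f (suc i) * (f zero * Q)
    ∏≡ = begin
      f zero * prodFin t (f ∘ suc)   ≡⟨ cong (f zero *_) ∏≡fi*Q ⟩
      f zero * (f (suc i) * Q)       ≡⟨ sym (*-assoc (f zero) (f (suc i)) Q) ⟩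
      f zero * f (suc i) * Q         ≡⟨ cong (_* Q) (*-comm (f zero) (f (suc i))) ⟩
      f (suc i) * f zero * Q         ≡⟨ *-assoc (f (suc i)) (f zero) Q ⟩
      f (suc i) * (f zero * Q)       ∎
      where open ≡-Reasoning
    q∤f₀*Q : ¬ q ∣ f zero * Q
    q∤f₀*Q q∣f₀*Q = [ q∤f zero (λ ()) , q∤Q ]′ (euclidsLemma _ _ q-prime q∣f₀*Q)

  ∏p^s∣∏p^e*y⇒p∣y : ∀ t (p s e : Fin t → ℕ) y → (∀ i → Prime (p i)) → (∀ i j → p i ≡ p j → i ≡ j) →
    ∀ i → e i < s i → prodFin t (λ j → p j ^ s j) ∣ prodFin t (λ j → p j ^ e j) * y → p i ∣ y
  ∏p^s∣∏p^e*y⇒p∣y t p s e y p-prime p-injective i eᵢ<sᵢ ∏p^s∣∏p^e*y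
    with prodFin-cofactor t (λ j → p j ^ e j) i (p-prime i)
           (λ j j≢i → prime∤prime^ (e j) (p-prime i) (p-prime j) (j≢i ∘ sym ∘ p-injective i j))
  ... | Q , ∏p^e≡ , pᵢ∤Q = [ ⊥-elim ∘ pᵢ∤Q , (λ pᵢ∣y → pᵢ∣y) ]′ (euclidsLemma Q y (p-prime i) pᵢ∣Q*y)
    where
    pᵢ∣Q*y : p i ∣ Q * y
    pᵢ∣Q*y = ^-∣-cancel (e i) (s i) (Q * y) {{prime⇒nonZero (p-prime i)}} eᵢ<sᵢ
      (∣-trans (∣-prodFin t (λ j → p j ^ s j) i)
        (subst (prodFin t (λ j → p j ^ s j) ∣_) (trans (cong (_* y) ∏p^e≡) (*-assoc (p i ^ e i) Q y))
               ∏p^s∣∏p^e*y))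

module MaxWhere where
  open import Data.Nat using (zero; suc; z≤n)
  open import Data.Nat.Properties using (≤-refl; m≤n⇒m≤1+n; <⇒≱)
  open import Data.Fin using (fromℕ; inject₁; lower₁)
  open import Data.Fin.Properties
    using (toℕ<n; toℕ-fromℕ; toℕ-inject₁; toℕ-injective; toℕ-lower₁; inject₁-lower₁)
  open import Data.Product using (∃-syntax; _×_; _,_)
  open import Data.Empty using (⊥-elim)
  open import Function using (_∘_)
  open import Level using (0ℓ)
  open import Relation.Nullary using (yes; no)
  open import Relation.Unary using (Pred; Decidable)
  open import Relation.Binary.PropositionalEquality using (sym; trans; cong; subst)

  maxWhere≤ : ∀ {m} (P : Pred (Fin m) 0ℓ) (P? : Decidable P) → maxWhere P P? ≤ m
  maxWhere≤ {zero}  P P? = z≤n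
  maxWhere≤ {suc m} P P? with P? (fromℕ m)
  ... | yes _ = ≤-refl
  ... | no  _ = m≤n⇒m≤1+n (maxWhere≤ (P ∘ inject₁) (P? ∘ inject₁))

  maxWhere≤⇒¬ : ∀ {m} (P : Pred (Fin m) 0ℓ) (P? : Decidable P) c → maxWhere P P? ≤ toℕ c → ¬ P c
  maxWhere≤⇒¬ {suc m} P P? c max≤c with P? (fromℕ m)
  ... | yes _  = ⊥-elim (<⇒≱ (toℕ<n c) max≤c)
  ... | no ¬Pm with m ≟ toℕ c
  ...   | yes m≡c = subst (¬_ ∘ P) (toℕ-injective (trans (toℕ-fromℕ m) m≡c)) ¬Pm
  ...   | no  m≢c = subst (¬_ ∘ P) (inject₁-lower₁ c m≢c)
                      (maxWhere≤⇒¬ (P ∘ inject₁) (P? ∘ inject₁) (lower₁ c m≢c)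
                        (subst (_ ≤_) (sym (toℕ-lower₁ c m≢c)) max≤c))

  maxWhere-last : ∀ {m} (P : Pred (Fin m) 0ℓ) (P? : Decidable P) →
    0 < maxWhere P P? → ∃[ c ] suc (toℕ c) ≡ maxWhere P P? × P c
  maxWhere-last {suc m} P P? 0<max with P? (fromℕ m)
  ... | yes Pm = fromℕ m , cong suc (toℕ-fromℕ m) , Pm
  ... | no  _ with maxWhere-last (P ∘ inject₁) (P? ∘ inject₁) 0<max
  ...   | c , c+1≡max , Pc = inject₁ c , trans (cong suc (toℕ-inject₁ c)) c+1≡max , Pc

open import Data.Nat using (z≤n; nonTrivial⇒n>1)
open import Data.Nat.Properties using (≤-trans; ≤-<-trans; ≤∧≢⇒<; ≤-pred)
open import Data.Nat.Divisibility using (∣-trans) renaming (_∣_ to _∣ℕ_)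
open import Data.Nat.Primality using (prime⇒nonTrivial)
open import Data.Integer using (_*_; ∣_∣)
open import Data.Integer.Properties using (abs-*)
open import Data.Integer.Divisibility.Signed using (_∣_; ∣ᵤ⇒∣; ∣⇒∣ᵤ; ∣-refl)
open import Data.Fin.Properties using (¬∀⟶∃¬)
open import Data.Product using (_,_)
open import Function using (_∘_)
open import Relation.Nullary.Decidable using (decidable-stable)
open import Relation.Binary.PropositionalEquality using (refl; subst; sym; cong)
open PrimePowers using (prodFin-cong; ∣-prodFin; m∣m^n; ∏p^s∣∏p^e*y⇒p∣y)
open MaxWhere
open InnerRankBounds

lemma2p11 : (t : ℕ) (p s : Fin t → ℕ) (h m n : ℕ) (α : Fin t → Fin m → ℕ) →
    (∀ i → Prime (p i)) → (∀ i j → p i ≡ p j → i ≡ j) → (∀ i → 1 ≤ s i) →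
    h ≡ prodFin t (λ i → p i ^ s i) → m ≤ n →
    (∀ i (c c' : Fin m) → toℕ c ≤ toℕ c' → α i c ≤ α i c') → (∀ i c → α i c ≤ s i) →
    (A : Mat m n) (S : Mat m m) (T : Mat n n) →
    IsInvertible h S → IsInvertible h T →
    MatEq h A ((S *M diag (λ c → + prodFin t (λ i → p i ^ α i c))) *M T) →
    InnerRank h A (maxWhere (λ c → ¬ (∀ i → α i c ≡ s i)) (λ c → ¬? (all? (λ i → α i c ≟ s i))))
lemma2p11 t p s h m n α p-prime p-injective 1≤s refl m≤n α-mono α≤s A S T
  (S' , _ , S'S≡I) (T' , _ , T'T≡I) A≡SDT =
  hasFactorization-truncate {A = A} S d T (≤-trans r≤m m≤n) h∣d A≡SDT , lower-bound
  where
  full? = λ c → all? (λ i → α i c ≟ s i)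
  d = λ c → + prodFin t (λ i → p i ^ α i c)
  r = maxWhere _ (¬? ∘ full?)
  r≤m = maxWhere≤ _ (¬? ∘ full?)
  h∣d : ∀ c → r ≤ toℕ c → + prodFin t (λ i → p i ^ s i) ∣ d c
  h∣d c r≤c = subst (λ e → + e ∣ d c) (prodFin-cong t (cong (p _ ^_) ∘ full)) ∣-refl
    where full = decidable-stable (full? c) (maxWhere≤⇒¬ _ (¬? ∘ full?) c r≤c)
  lower-bound : ∀ k → k < r → ¬ HasFactorization _ A k
  lower-bound k k<r with maxWhere-last _ (¬? ∘ full?) (≤-<-trans z≤n k<r)
  ... | c₀ , c₀+1≡r , ¬full with ¬∀⟶∃¬ t _ (λ i → α i c₀ ≟ s i) ¬full
  ...   | i₀ , αc₀≢s = no-factorization-below {A = A} {S' = S'} {T' = T'} d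
    (nonTrivial⇒n>1 _ {{prime⇒nonTrivial (p-prime i₀)}})
    (∣-trans (m∣m^n (p i₀) (1≤s i₀)) (∣-prodFin t (λ i → p i ^ s i) i₀))
    r≤m m≤n S'S≡I T'T≡I A≡SDT d-regular k<r
    where
    αᵢ₀<sᵢ₀ : ∀ c → toℕ c < r → α i₀ c < s i₀
    αᵢ₀<sᵢ₀ c c<r = ≤-<-trans (α-mono i₀ c c₀ (≤-pred (subst (toℕ c <_) (sym c₀+1≡r) c<r)))
                              (≤∧≢⇒< (α≤s i₀ c₀) αc₀≢s)
    d-regular : ∀ c → toℕ c < r → ∀ y → + prodFin t (λ i → p i ^ s i) ∣ d c * y → + p i₀ ∣ y
    d-regular c c<r y h∣dy = ∣ᵤ⇒∣ (∏p^s∣∏p^e*y⇒p∣y t p s (λ i → α i c) ∣ y ∣ p-prime p-injective i₀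
      (αᵢ₀<sᵢ₀ c c<r) (subst (_ ∣ℕ_) (abs-* (d c) y) (∣⇒∣ᵤ h∣dy)))
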